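{- For every graph $G$, $h(G)\le \mathbf{pw}(G)+1$. Moreover, this bound is tight for graphs of pathwidth at least $2$: for every integer $k\ge2$ there exists a graph $G$ with $\mathbf{pw}(G)=k$ and $h(G)=k+1$.
   Context: All graphs are finite, undirected, without loops or multiple edges. A path decomposition of $G$ is a sequence $(X_1,\ldots,X_\ell)$ of subsets of $V(G)$ such that $\bigcup_i X_i=V(G)$, every edge has both endpoints in some $X_i$, and for every vertex $x$, if $x\in X_i\cap X_j$ with $i\le j$ then $x\in X_r$ for all $i\le r\le j$. Its width is $\max_i|X_i|-1$, and $\mathbf{pw}(G)$ is the minimum width of a path decomposition of $G$. Hunters \& Rabbit game on $G$ with $k$ hunters: a hunters' strategy is a sequence $\mathcal H=(H_1,H_2,\ldots)$ of sets $H_i\subseteq V(G)$ with $|H_i|\le k$. A rabbit's strategy is a sequence $(r_0,r_1,\ldots)$ of vertices with $r_i$ adjacent to $r_{i-1}$ for all $i\ge1$. $\mathcal H$ is winning if for every rabbit's strategy there is $i\ge1$ with $r_{i-1}\in H_i$. The hunter number $h(G)$ is the minimum $k$ such that $k$ hunters have a winning strategy on $G$. -}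

module Defs where

open import Level using (0ℓ)
open import Data.Nat using (ℕ; zero; suc; _≤_; _∸_; _⊔_; _+_)
open import Data.Fin using (Fin; toℕ)
open import Data.Fin.Subset using (Subset; _∈_; ∣_∣)
open import Data.List using (List; foldr; map; allFin)
open import Data.Product using (Σ; ∃; ∃-syntax; _×_; _,_; proj₁)
open import Relation.Binary.PropositionalEquality using (_≡_)
open import Relation.Nullary using (¬_)

record Graph : Set₁ where
  field
    n      : ℕ
    Adj    : Fin n → Fin n → Set
    sym    : ∀ {u v} → Adj u v → Adj v u
    irrefl : ∀ {u} → ¬ Adj u u
open Graph public

record PathDecomposition (G : Graph) : Set where
  field
    ℓ     : ℕ
    bag   : Fin ℓ → Subset (n G)
    cover : ∀ (v : Fin (n G)) → ∃[ i ] (v ∈ bag i)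
    edges : ∀ (u v : Fin (n G)) → Adj G u v → ∃[ i ] (u ∈ bag i × v ∈ bag i)
    interpolation : ∀ (x : Fin (n G)) (i r j : Fin ℓ) →
                    toℕ i ≤ toℕ r → toℕ r ≤ toℕ j →
                    x ∈ bag i → x ∈ bag j → x ∈ bag r
open PathDecomposition public

-- max_i |X_i|  (0 for the empty sequence)
maxBag : ∀ {G} → PathDecomposition G → ℕ
maxBag D = foldr _⊔_ 0 (map (λ i → ∣ bag D i ∣) (allFin (ℓ D)))

width : ∀ {G} → PathDecomposition G → ℕ
width D = maxBag D ∸ 1

IsPathwidth : Graph → ℕ → Set
IsPathwidth G p = (∃[ D ] (width {G} D ≡ p)) × (∀ (D : PathDecomposition G) → p ≤ width D)

-- Hunters' strategy with k hunters: H i stands for H_{i+1}, |H_{i+1}| ≤ k.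
HunterStrategy : Graph → ℕ → Set
HunterStrategy G k = Σ (ℕ → Subset (n G)) (λ H → ∀ i → ∣ H i ∣ ≤ k)

RabbitStrategy : Graph → Set
RabbitStrategy G = Σ (ℕ → Fin (n G)) (λ r → ∀ i → Adj G (r i) (r (suc i)))

-- Winning: for every rabbit's strategy there is i ≥ 1 with r_{i-1} ∈ H_i,
-- i.e. (shifting indices) some i with r i ∈ H i.
Winning : (G : Graph) {k : ℕ} → HunterStrategy G k → Set
Winning G (H , _) = ∀ (R : RabbitStrategy G) → ∃[ i ] (proj₁ R i ∈ H i)

HuntersWin : Graph → ℕ → Set
HuntersWin G k = Σ (HunterStrategy G k) (Winning G)

IsHunterNumber : Graph → ℕ → Set
IsHunterNumber G h = HuntersWin G h × (∀ k → HuntersWin G k → h ≤ k)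

module Submission where

-- Upper bound: given a path decomposition of width p, p + 1 hunters shoot
-- the bags one per round.  The bags containing a vertex form an interval,
-- so a rabbit that has avoided the bags shot so far stays ahead of the
-- sweep, until it runs out of bags (Sweep).
--
-- Tightness: G_j is the graph B on 0,…,9 (a ~ b iff 0 < |a − b| ≤ 2)
-- joined with a clique K_j, and k = j + 2.  The bags {c, c+1, c+2} ∪ K_j
-- have width k, and the clique {0, 1, 2} ∪ K_j forces width ≥ k since a
-- clique lies inside one bag.  Against k hunters the rabbit follows an
-- escape plan (EscapePlan): either some clique vertex is free, or at most
-- two hunters shoot at B, where a safety certificate, verified by
-- evaluation, keeps the rabbit alive.

open import Defs hiding (sym)
open import Level using (0ℓ)
open import Function using (_∘_)
open import Function.Bundles using (Equivalence)
open import Data.Nat using (ℕ; zero; suc; _≤_; _<_; _+_; _∸_; _⊔_; z≤n; s≤s; _≤?_; _<?_; _≤ᵇ_; _≡ᵇ_)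
open import Data.Nat.Properties hiding (_≟_)
open import Data.Bool using (Bool; true; false; not; _∧_; _∨_)
open import Data.Bool.Properties using (T-≡; ∧-conicalˡ; ∧-conicalʳ; ∨-zeroʳ; not-involutive)
open import Data.Bool.ListAction using (all; any)
open import Data.Unit using (tt) renaming (⊤ to Unit)
open import Data.Empty using (⊥-elim)
open import Data.Product using (∃; ∃-syntax; _×_; _,_; proj₁; proj₂)
open import Data.Sum using (_⊎_; inj₁; inj₂)
open import Data.Fin using (Fin; zero; suc; toℕ; fromℕ<; _↑ˡ_; _↑ʳ_; splitAt; _≟_)
open import Data.Fin.Patterns
open import Data.Fin.Properties
  using (¬∀⟶∃¬; toℕ-injective; toℕ-fromℕ<; toℕ<n; splitAt-↑ˡ; splitAt-↑ʳ; splitAt⁻¹-↑ˡ; splitAt⁻¹-↑ʳ)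
open import Data.Fin.Subset
  using (Subset; _∈_; _∉_; ∣_∣; _∪_; ⁅_⁆; _⊆_; Nonempty; inside; outside) renaming (⊤ to full; ⊥ to ∅)
open import Data.Fin.Subset.Properties
  using (_∈?_; _⊆?_; nonempty?; Empty-unique; ∣⊥∣≡0; ∣⊤∣≡n; ∈⊤; p⊆q⇒∣p∣≤∣q∣; ∣⁅x⁆∣≡1; x∈⁅x⁆; p⊆p∪q; q⊆p∪q)
open import Data.Vec using ([]; _∷_; _++_; here; there; tabulate; take; drop)
open import Data.Vec.Properties using (lookup⇒[]=; []=⇒lookup; lookup∘tabulate; take++drop≡id)
open import Data.List using (List; []; _∷_; map; length; allFin; filter; foldr)
open import Data.List.Properties using (length-map)
open import Data.List.Membership.Propositional using () renaming (_∈_ to _∈ₗ_)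
open import Data.List.Membership.Propositional.Properties using (∈-map⁺; ∈-map⁻; ∈-allFin; ∈-filter⁺; ∈-filter⁻)
open import Data.List.Relation.Unary.Any using (satisfied) renaming (here to hereₗ; there to thereₗ)
import Data.List.Relation.Unary.All as All
open import Data.List.Relation.Unary.All.Properties using (all⁺)
open import Data.List.Relation.Unary.Any.Properties using (any⁻)
open import Data.List.Extrema.Nat using (argmax; argmin; argmax-sel; argmin-sel; f[xs]≤f[argmax]; f[argmin]≤f[xs])
open import Relation.Nullary using (¬_; yes; no; contradiction)
open import Relation.Nullary.Decidable using (does; dec-true; dec-false; _→-dec_)
open import Relation.Unary using (Pred; Decidable)
open import Relation.Binary.PropositionalEquality using (_≡_; _≢_; refl; cong; cong₂; subst; sym; trans)

-- Boolean quantifiers over Fin n.  Finite facts about the small example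
-- graph below are established by evaluating such a boolean to true.
allᶠ : ∀ {n} → (Fin n → Bool) → Bool
allᶠ p = all p (allFin _)

anyᶠ : ∀ {n} → (Fin n → Bool) → Bool
anyᶠ p = any p (allFin _)

allᶠ-sound : ∀ {n} (p : Fin n → Bool) → allᶠ p ≡ true → ∀ x → p x ≡ true
allᶠ-sound p check x =
  Equivalence.to T-≡ (All.lookup (all⁺ p (allFin _) (Equivalence.from T-≡ check)) (∈-allFin x))

anyᶠ-sound : ∀ {n} (p : Fin n → Bool) → anyᶠ p ≡ true → ∃ λ x → p x ≡ true
anyᶠ-sound p check with satisfied (any⁻ p (allFin _) (Equivalence.from T-≡ check))
... | x , px = x , Equivalence.to T-≡ px

allᶠ² : ∀ {m n} → (Fin m → Fin n → Bool) → Bool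
allᶠ² p = allᶠ λ a → allᶠ (p a)

allᶠ²-sound : ∀ {m n} (p : Fin m → Fin n → Bool) → allᶠ² p ≡ true → ∀ a b → p a b ≡ true
allᶠ²-sound p check a = allᶠ-sound (p a) (allᶠ-sound (λ a → allᶠ (p a)) check a)

module _ {n} {P : Pred (Fin n) 0ℓ} (P? : Decidable P) (f : Fin n → ℕ) where

  private
    members : List (Fin n)
    members = filter P? (allFin n)

    member : ∀ {x} → P x → x ∈ₗ members
    member {x} = ∈-filter⁺ P? {xs = allFin n} (∈-allFin x)

    selected : ∀ {x₀ v} → P x₀ → v ≡ x₀ ⊎ v ∈ₗ members → P v
    selected Px₀ (inj₁ refl) = Px₀
    selected Px₀ (inj₂ v∈)   = proj₂ (∈-filter⁻ P? {xs = allFin n} v∈)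

  argmaxIn : ∃ P → ∃ λ v → P v × (∀ {x} → P x → f x ≤ f v)
  argmaxIn (x₀ , Px₀) =
    argmax f x₀ members , selected Px₀ (argmax-sel f x₀ members) ,
    λ Px → All.lookup (f[xs]≤f[argmax] x₀ members) (member Px)

  argminIn : ∃ P → ∃ λ v → P v × (∀ {x} → P x → f v ≤ f x)
  argminIn (x₀ , Px₀) =
    argmin f x₀ members , selected Px₀ (argmin-sel f x₀ members) ,
    λ Px → All.lookup (f[argmin]≤f[xs] x₀ members) (member Px)

full⇒n≤∣S∣ : ∀ {n} (S : Subset n) → (∀ x → x ∈ S) → n ≤ ∣ S ∣
full⇒n≤∣S∣ {n} S all∈ = subst (_≤ ∣ S ∣) (∣⊤∣≡n n) (p⊆q⇒∣p∣≤∣q∣ {p = full} (λ {x} _ → all∈ x))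

missing : ∀ {n} (S : Subset n) → ∣ S ∣ < n → ∃ λ x → x ∉ S
missing {n} S ∣S∣<n = ¬∀⟶∃¬ n (_∈ S) (_∈? S) λ all∈ → <⇒≱ ∣S∣<n (full⇒n≤∣S∣ S all∈)

∣p∪q∣≤∣p∣+∣q∣ : ∀ {n} (p q : Subset n) → ∣ p ∪ q ∣ ≤ ∣ p ∣ + ∣ q ∣
∣p∪q∣≤∣p∣+∣q∣ []            []            = z≤n
∣p∪q∣≤∣p∣+∣q∣ (outside ∷ p) (outside ∷ q) = ∣p∪q∣≤∣p∣+∣q∣ p q
∣p∪q∣≤∣p∣+∣q∣ (outside ∷ p) (inside ∷ q)  =
  ≤-trans (s≤s (∣p∪q∣≤∣p∣+∣q∣ p q)) (≤-reflexive (sym (+-suc ∣ p ∣ ∣ q ∣)))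
∣p∪q∣≤∣p∣+∣q∣ (inside ∷ p)  (outside ∷ q) = s≤s (∣p∪q∣≤∣p∣+∣q∣ p q)
∣p∪q∣≤∣p∣+∣q∣ (inside ∷ p)  (inside ∷ q)  =
  s≤s (≤-trans (∣p∪q∣≤∣p∣+∣q∣ p q) (+-monoʳ-≤ ∣ p ∣ (n≤1+n ∣ q ∣)))

missingBesides : ∀ {n} (S : Subset n) → 2 + ∣ S ∣ ≤ n → ∀ y → ∃ λ x → x ∉ S × x ≢ y
missingBesides {n} S 2+∣S∣≤n y with missing (S ∪ ⁅ y ⁆) bound
  where
  open ≤-Reasoning
  bound : ∣ S ∪ ⁅ y ⁆ ∣ < n
  bound = begin-strict
    ∣ S ∪ ⁅ y ⁆ ∣     ≤⟨ ∣p∪q∣≤∣p∣+∣q∣ S ⁅ y ⁆ ⟩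
    ∣ S ∣ + ∣ ⁅ y ⁆ ∣ ≡⟨ cong (∣ S ∣ +_) (∣⁅x⁆∣≡1 y) ⟩
    ∣ S ∣ + 1         ≡⟨ +-comm ∣ S ∣ 1 ⟩
    1 + ∣ S ∣         <⟨ n<1+n (1 + ∣ S ∣) ⟩
    2 + ∣ S ∣         ≤⟨ 2+∣S∣≤n ⟩
    n                 ∎
... | x , x∉S∪y = x , (λ x∈S → x∉S∪y (p⊆p∪q ⁅ y ⁆ x∈S)) ,
                  (λ { refl → x∉S∪y (q⊆p∪q S ⁅ y ⁆ (x∈⁅x⁆ y)) })

elements : ∀ {n} → Subset n → List (Fin n)
elements []            = []
elements (inside ∷ S)  = zero ∷ map suc (elements S)
elements (outside ∷ S) = map suc (elements S)

∈-elements : ∀ {n} {S : Subset n} {x} → x ∈ S → x ∈ₗ elements S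
∈-elements {S = inside ∷ S}  here        = hereₗ refl
∈-elements {S = inside ∷ S}  (there x∈S) = thereₗ (∈-map⁺ suc (∈-elements x∈S))
∈-elements {S = outside ∷ S} (there x∈S) = ∈-map⁺ suc (∈-elements x∈S)

length-elements : ∀ {n} (S : Subset n) → length (elements S) ≡ ∣ S ∣
length-elements []            = refl
length-elements (inside ∷ S)  = cong suc (trans (length-map suc (elements S)) (length-elements S))
length-elements (outside ∷ S) = trans (length-map suc (elements S)) (length-elements S)

Covers : ∀ {n} → Fin n × Fin n → Subset n → Set
Covers (x , y) S = ∀ {z} → z ∈ S → z ≡ x ⊎ z ≡ y

pairCover : ∀ {n} (S : Subset (suc n)) → ∣ S ∣ ≤ 2 → ∃ λ s → Covers s S
pairCover {n} S ∣S∣≤2 with listCover (elements S) (subst (_≤ 2) (sym (length-elements S)) ∣S∣≤2)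
  where
  listCover : (xs : List (Fin (suc n))) → length xs ≤ 2 →
              ∃ λ s → ∀ {z} → z ∈ₗ xs → z ≡ proj₁ s ⊎ z ≡ proj₂ s
  listCover []               _ = (zero , zero) , λ ()
  listCover (x ∷ [])         _ = (x , x) , λ { (hereₗ z≡x) → inj₁ z≡x }
  listCover (x ∷ y ∷ [])     _ = (x , y) , λ { (hereₗ z≡x) → inj₁ z≡x ; (thereₗ (hereₗ z≡y)) → inj₂ z≡y }
  listCover (_ ∷ _ ∷ _ ∷ _) (s≤s (s≤s ()))
... | s , covers = s , λ z∈S → covers (∈-elements z∈S)

⊈⇒∃ : ∀ {n} {p q : Subset n} → ¬ p ⊆ q → ∃ λ x → x ∈ p × x ∉ q
⊈⇒∃ {n} {p} {q} p⊈q with ¬∀⟶∃¬ n (λ x → x ∈ p → x ∈ q) (λ x → x ∈? p →-dec x ∈? q) (λ p⊆q → p⊈q (p⊆q _))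
... | x , ¬x∈p⇒x∈q with x ∈? p
...   | yes x∈p = x , x∈p , λ x∈q → ¬x∈p⇒x∈q (λ _ → x∈q)
...   | no  x∉p = ⊥-elim (¬x∈p⇒x∈q (λ x∈p → ⊥-elim (x∉p x∈p)))

∣++∣ : ∀ {m n} (xs : Subset m) (ys : Subset n) → ∣ xs ++ ys ∣ ≡ ∣ xs ∣ + ∣ ys ∣
∣++∣ []             ys = refl
∣++∣ (inside ∷ xs)  ys = cong suc (∣++∣ xs ys)
∣++∣ (outside ∷ xs) ys = ∣++∣ xs ys

∈-++ˡ⁺ : ∀ {m n} {xs : Subset m} {ys : Subset n} {a} → a ∈ xs → (a ↑ˡ n) ∈ xs ++ ys
∈-++ˡ⁺ here       = here
∈-++ˡ⁺ (there a∈) = there (∈-++ˡ⁺ a∈)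

∈-++ˡ⁻ : ∀ {m n} (xs : Subset m) {ys : Subset n} {a} → (a ↑ˡ n) ∈ xs ++ ys → a ∈ xs
∈-++ˡ⁻ (_ ∷ xs) {a = zero}  here       = here
∈-++ˡ⁻ (_ ∷ xs) {a = suc a} (there a∈) = there (∈-++ˡ⁻ xs a∈)

∈-++ʳ⁺ : ∀ {m n} (xs : Subset m) {ys : Subset n} {u} → u ∈ ys → (m ↑ʳ u) ∈ xs ++ ys
∈-++ʳ⁺ []       u∈ = u∈
∈-++ʳ⁺ (_ ∷ xs) u∈ = there (∈-++ʳ⁺ xs u∈)

∈-++ʳ⁻ : ∀ {m n} (xs : Subset m) {ys : Subset n} {u} → (m ↑ʳ u) ∈ xs ++ ys → u ∈ ys
∈-++ʳ⁻ []       u∈         = u∈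
∈-++ʳ⁻ (_ ∷ xs) (there u∈) = ∈-++ʳ⁻ xs u∈

∈-tabulate⁺ : ∀ {n} (f : Fin n → Bool) {x} → f x ≡ true → x ∈ tabulate f
∈-tabulate⁺ f {x} fx = lookup⇒[]= x (tabulate f) (trans (lookup∘tabulate f x) fx)

∈-tabulate⁻ : ∀ {n} (f : Fin n → Bool) {x} → x ∈ tabulate f → f x ≡ true
∈-tabulate⁻ f {x} x∈ = trans (sym (lookup∘tabulate f x)) ([]=⇒lookup x∈)

_⇒ᵇ_ : Bool → Bool → Bool
b ⇒ᵇ c = not b ∨ c

modus-ponens : ∀ {b c} → b ⇒ᵇ c ≡ true → b ≡ true → c ≡ true
modus-ponens c≡true refl = c≡true

huntersWin-mono : ∀ {G k k′} → k ≤ k′ → HuntersWin G k → HuntersWin G k′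
huntersWin-mono k≤k′ ((H , ∣H∣≤k) , win) = (H , λ i → ≤-trans (∣H∣≤k i) k≤k′) , win

isHunterNumber : ∀ {G h} → HuntersWin G h → (∀ m → m < h → ¬ HuntersWin G m) → IsHunterNumber G h
isHunterNumber win fewerLose = win , λ m win-m → ≮⇒≥ λ m<h → fewerLose m m<h win-m

≤-foldr⊔ : ∀ {x xs} → x ∈ₗ xs → x ≤ foldr _⊔_ 0 xs
≤-foldr⊔ {xs = y ∷ ys} (hereₗ refl) = m≤m⊔n y _
≤-foldr⊔ {xs = y ∷ ys} (thereₗ x∈) = ≤-trans (≤-foldr⊔ x∈) (m≤n⊔m y _)

foldr⊔-≤ : ∀ {s} xs → (∀ {x} → x ∈ₗ xs → x ≤ s) → foldr _⊔_ 0 xs ≤ s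
foldr⊔-≤ []       _     = z≤n
foldr⊔-≤ (x ∷ xs) bound = ⊔-lub (bound (hereₗ refl)) (foldr⊔-≤ xs (bound ∘ thereₗ))

bagSizes : ∀ {G} → PathDecomposition G → List ℕ
bagSizes D = map (λ i → ∣ bag D i ∣) (allFin (ℓ D))

∣bag∣≤maxBag : ∀ {G} (D : PathDecomposition G) c → ∣ bag D c ∣ ≤ maxBag D
∣bag∣≤maxBag D c = ≤-foldr⊔ {xs = bagSizes D} (∈-map⁺ (λ i → ∣ bag D i ∣) (∈-allFin c))

maxBag-exact : ∀ {G s} (D : PathDecomposition G) → (∀ c → ∣ bag D c ∣ ≡ s) → Fin (ℓ D) → maxBag D ≡ s
maxBag-exact {s = s} D size c₀ = ≤-antisym
  (foldr⊔-≤ (bagSizes D) λ x∈ →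
    let c , _ , x≡ = ∈-map⁻ (λ i → ∣ bag D i ∣) {xs = allFin (ℓ D)} x∈ in ≤-reflexive (trans x≡ (size c)))
  (subst (_≤ maxBag D) (size c₀) (∣bag∣≤maxBag D c₀))

maxBag≤width+1 : ∀ {G} (D : PathDecomposition G) → maxBag D ≤ width D + 1
maxBag≤width+1 D = ≤-trans (m≤n+m∸n (maxBag D) 1) (≤-reflexive (+-comm 1 (width D)))

-- Given a path decomposition D, the hunters shoot at bag i in
-- round i (and at nobody after the last bag).  Since the bags containing
-- an edge's ends form an interval, a rabbit that avoided bags 0,…,i at
-- time i avoids bags 0,…,i+1 at time i+1 unless it sits in bag i+1; by the
-- last round it would avoid every bag, contradicting that bags cover V(G).
module Sweep {G : Graph} (D : PathDecomposition G) where

  shots : ℕ → Subset (n G)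
  shots i with i <? ℓ D
  ... | yes i<ℓ = bag D (fromℕ< i<ℓ)
  ... | no  _   = ∅

  shots-at : ∀ {i} (i<ℓ : i < ℓ D) → shots i ≡ bag D (fromℕ< i<ℓ)
  shots-at {i} i<ℓ with i <? ℓ D
  ... | yes _   = refl
  ... | no  i≮ℓ = contradiction i<ℓ i≮ℓ

  ∣shots∣≤maxBag : ∀ i → ∣ shots i ∣ ≤ maxBag D
  ∣shots∣≤maxBag i with i <? ℓ D
  ... | yes i<ℓ = ∣bag∣≤maxBag D (fromℕ< i<ℓ)
  ... | no  _   = ≤-trans (≤-reflexive (∣⊥∣≡0 (n G))) z≤n

  module _ (r : ℕ → Fin (n G)) (walk : ∀ i → Adj G (r i) (r (suc i))) where

    Caught : Set
    Caught = ∃ λ i → r i ∈ shots i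

    Unseen : ℕ → Set
    Unseen i = ∀ c → toℕ c ≤ i → r i ∉ bag D c

    unseen-first : (c : Fin (ℓ D)) → toℕ c ≡ 0 → r 0 ∉ bag D c → Unseen 0
    unseen-first c c≡0 r∉c d d≤0 =
      r∉c ∘ subst (λ d → r 0 ∈ bag D d) (toℕ-injective (trans (n≤0⇒n≡0 d≤0) (sym c≡0)))

    -- The edge r i – r (i+1) lies in some bag e.  Bag e comes after i
    -- because r i is unseen, so bag c = i+1 lies between any earlier bag
    -- containing r (i+1) and bag e.
    unseen-next : ∀ {i} → Unseen i → (c : Fin (ℓ D)) → toℕ c ≡ suc i → r (suc i) ∉ bag D c →
                  Unseen (suc i)
    unseen-next {i} unseen c c≡ r∉c d d≤ r∈d with edges D (r i) (r (suc i)) (walk i)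
    ... | e , rᵢ∈e , rᵢ₊₁∈e with toℕ e ≤? i
    ...   | yes e≤i = unseen e e≤i rᵢ∈e
    ...   | no  e≰i = r∉c (interpolation D (r (suc i)) d c e
                             (subst (toℕ d ≤_) (sym c≡) d≤) (subst (_≤ toℕ e) (sym c≡) (≰⇒> e≰i))
                             r∈d rᵢ₊₁∈e)

    caughtOrUnseen : ∀ i → i < ℓ D → Caught ⊎ Unseen i
    caughtOrUnseen i i<ℓ with r i ∈? bag D (fromℕ< i<ℓ)
    ... | yes r∈c = inj₁ (i , subst (r i ∈_) (sym (shots-at i<ℓ)) r∈c)
    caughtOrUnseen zero i<ℓ | no r∉c = inj₂ (unseen-first _ (toℕ-fromℕ< i<ℓ) r∉c)
    caughtOrUnseen (suc i) i<ℓ | no r∉c with caughtOrUnseen i (<-trans (n<1+n i) i<ℓ)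
    ... | inj₁ caught = inj₁ caught
    ... | inj₂ unseen = inj₂ (unseen-next unseen _ (toℕ-fromℕ< i<ℓ) r∉c)

    -- Some bag exists (the one covering r 0), so there is a last round m;
    -- unless caught by then, the rabbit avoids every bag at time m.
    caught : Caught
    caught with cover D (r 0)
    ... | c₀ , _ = lastRound (ℓ D) refl c₀
      where
      lastRound : ∀ l → ℓ D ≡ l → Fin l → Caught
      lastRound (suc m) ℓ≡ _ with caughtOrUnseen m (subst (m <_) (sym ℓ≡) (n<1+n m))
      ... | inj₁ caught = caught
      ... | inj₂ unseen with cover D (r m)
      ...   | c , r∈c = contradiction r∈c (unseen c (≤-pred (subst (toℕ c <_) ℓ≡ (toℕ<n c))))

  sweep : HuntersWin G (maxBag D)
  sweep = (shots , ∣shots∣≤maxBag) , λ (r , walk) → caught r walk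

huntersWin-width+1 : ∀ {G} (D : PathDecomposition G) → HuntersWin G (width D + 1)
huntersWin-width+1 {G} D = huntersWin-mono {G} (maxBag≤width+1 D) (Sweep.sweep D)

-- Lower bound on the width: a clique Q fits in one bag (Helly property of
-- intervals).  Let v ∈ Q be the member whose first bag comes last.  For any
-- other x ∈ Q the edge x – v sits in a bag e at or after v's first bag, and
-- x's own first bag is no later than v's, so by interpolation x lies in
-- v's first bag.
IsClique : (G : Graph) → Subset (n G) → Set
IsClique G Q = ∀ {x y} → x ∈ Q → y ∈ Q → x ≢ y → Adj G x y

module _ {G : Graph} (D : PathDecomposition G) where

  firstBag : ∀ x → ∃ λ c → x ∈ bag D c × (∀ {d} → x ∈ bag D d → toℕ c ≤ toℕ d)
  firstBag x = argminIn (λ c → x ∈? bag D c) toℕ (cover D x)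

  first : Fin (n G) → ℕ
  first x = toℕ (proj₁ (firstBag x))

  cliqueInBag : ∀ {Q} → IsClique G Q → Nonempty Q → ∃ λ c → Q ⊆ bag D c
  cliqueInBag {Q} clique nonempty = latestFirstBag (argmaxIn (_∈? Q) first nonempty)
    where
    latestFirstBag : (∃ λ v → v ∈ Q × (∀ {x} → x ∈ Q → first x ≤ first v)) → ∃ λ c → Q ⊆ bag D c
    latestFirstBag (v , v∈Q , v-last) = proj₁ (firstBag v) , contained
      where
      contained : Q ⊆ bag D (proj₁ (firstBag v))
      contained {x} x∈Q with x ≟ v
      ... | yes refl = proj₁ (proj₂ (firstBag v))
      ... | no  x≢v with edges D x v (clique x∈Q v∈Q x≢v)
      ...   | e , x∈e , v∈e = interpolation D x (proj₁ (firstBag x)) (proj₁ (firstBag v)) e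
                                (v-last x∈Q) (proj₂ (proj₂ (firstBag v)) v∈e)
                                (proj₁ (proj₂ (firstBag x))) x∈e

  ∣clique∣≤maxBag : ∀ {Q} → IsClique G Q → ∣ Q ∣ ≤ maxBag D
  ∣clique∣≤maxBag {Q} clique with nonempty? Q
  ... | yes nonempty = let c , Q⊆c = cliqueInBag clique nonempty in
                       ≤-trans (p⊆q⇒∣p∣≤∣q∣ Q⊆c) (∣bag∣≤maxBag D c)
  ... | no  empty    = subst (_≤ maxBag D) (sym (trans (cong ∣_∣ (Empty-unique empty)) (∣⊥∣≡0 (n G)))) z≤n

  width≥∣clique∣-1 : ∀ {Q} → IsClique G Q → ∣ Q ∣ ∸ 1 ≤ width D
  width≥∣clique∣-1 clique = ∸-monoˡ-≤ 1 (∣clique∣≤maxBag clique)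

-- An escape plan against k hunters is a
-- relation Safe x H H′ — the rabbit sits on x, missed by the current shot
-- H, and is prepared for the next shot H′ — that can be entered at the
-- start and maintained by a single move, whatever shots of size ≤ k come.
record EscapePlan (G : Graph) (k : ℕ) : Set₁ where
  field
    Safe   : Fin (n G) → Subset (n G) → Subset (n G) → Set
    missed : ∀ {x H H′} → Safe x H H′ → x ∉ H
    start  : ∀ H H′ → ∣ H ∣ ≤ k → ∣ H′ ∣ ≤ k → ∃ λ x → Safe x H H′
    move   : ∀ {x H} H′ H″ → ∣ H′ ∣ ≤ k → ∣ H″ ∣ ≤ k → Safe x H H′ →
             ∃ λ y → Adj G x y × Safe y H′ H″

escape : ∀ {G k} → EscapePlan G k → ¬ HuntersWin G k
escape {G} {k} plan ((H , ∣H∣≤k) , win) = let i , rᵢ∈Hᵢ = win (r , steps) in missed (proj₂ (state i)) rᵢ∈Hᵢ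
  where
  open EscapePlan plan

  State : ℕ → Set
  State i = ∃ λ x → Safe x (H i) (H (suc i))

  state : ∀ i → State i
  step  : ∀ i → ∃ λ y → Adj G (proj₁ (state i)) y × Safe y (H (suc i)) (H (suc (suc i)))
  state zero    = start (H 0) (H 1) (∣H∣≤k 0) (∣H∣≤k 1)
  state (suc i) = proj₁ (step i) , proj₂ (proj₂ (step i))
  step i = move (H (suc i)) (H (suc (suc i))) (∣H∣≤k (suc i)) (∣H∣≤k (suc (suc i))) (proj₂ (state i))

  r : ℕ → Fin (n G)
  r i = proj₁ (state i)

  steps : ∀ i → Adj G (r i) (r (suc i))
  steps i = proj₁ (proj₂ (step i))

near : Fin 10 → Fin 10 → Bool
near a b = (toℕ a ∸ toℕ b ≤ᵇ 2) ∧ (toℕ b ∸ toℕ a ≤ᵇ 2) ∧ not (toℕ a ≡ᵇ toℕ b)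

near-sym : ∀ a b → near a b ≡ true → near b a ≡ true
near-sym a b = modus-ponens (allᶠ²-sound (λ a b → near a b ⇒ᵇ near b a) refl a b)

near-irrefl : ∀ a → near a a ≢ true
near-irrefl a a~a with trans (sym (allᶠ-sound (λ a → not (near a a)) refl a)) (cong not a~a)
... | ()

-- B has pathwidth 2: the bands {c, c+1, c+2}, c = 0,…,7, form a path
-- decomposition of B, and band 0 is a triangle.
inBand : Fin 8 → Fin 10 → Bool
inBand c a = (toℕ c ≤ᵇ toℕ a) ∧ (toℕ a ≤ᵇ 2 + toℕ c)

band : Fin 8 → Subset 10
band c = tabulate (inBand c)

≤ᵇ-sound : ∀ {m n} → (m ≤ᵇ n) ≡ true → m ≤ n
≤ᵇ-sound {m} {n} m≤ᵇn = ≤ᵇ⇒≤ m n (Equivalence.from T-≡ m≤ᵇn)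

≤ᵇ-complete : ∀ {m n} → m ≤ n → (m ≤ᵇ n) ≡ true
≤ᵇ-complete m≤n = Equivalence.to T-≡ (≤⇒≤ᵇ m≤n)

band⁻ : ∀ {c a} → a ∈ band c → toℕ c ≤ toℕ a × toℕ a ≤ 2 + toℕ c
band⁻ {c} {a} a∈ = ≤ᵇ-sound (∧-conicalˡ _ _ bounds) , ≤ᵇ-sound (∧-conicalʳ (toℕ c ≤ᵇ toℕ a) _ bounds)
  where bounds = ∈-tabulate⁻ (inBand c) a∈

band⁺ : ∀ {c a} → toℕ c ≤ toℕ a → toℕ a ≤ 2 + toℕ c → a ∈ band c
band⁺ {c} c≤a a≤c+2 = ∈-tabulate⁺ (inBand c) (cong₂ _∧_ (≤ᵇ-complete c≤a) (≤ᵇ-complete a≤c+2))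

band-interpolation : ∀ {c r l a} → toℕ c ≤ toℕ r → toℕ r ≤ toℕ l →
                     a ∈ band c → a ∈ band l → a ∈ band r
band-interpolation c≤r r≤l a∈c a∈l =
  band⁺ (≤-trans r≤l (proj₁ (band⁻ a∈l))) (≤-trans (proj₂ (band⁻ a∈c)) (+-monoʳ-≤ 2 c≤r))

band-size : ∀ c → ∣ band c ∣ ≡ 3
band-size c = ≡ᵇ⇒≡ _ 3 (Equivalence.from T-≡ (allᶠ-sound (λ c → ∣ band c ∣ ≡ᵇ 3) refl c))

band-cover : ∀ a → ∃ λ c → a ∈ band c
band-cover a with anyᶠ-sound (λ c → inBand c a) (allᶠ-sound (λ a → anyᶠ λ c → inBand c a) refl a)
... | c , a∈c = c , ∈-tabulate⁺ (inBand c) a∈c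

band-edge : ∀ {a b} → near a b ≡ true → ∃ λ c → a ∈ band c × b ∈ band c
band-edge {a} {b} a~b = inBoth (anyᶠ-sound (λ c → inBand c a ∧ inBand c b) (modus-ponens edgeInBand a~b))
  where
  edgeInBand : (near a b ⇒ᵇ anyᶠ λ c → inBand c a ∧ inBand c b) ≡ true
  edgeInBand = allᶠ²-sound (λ a b → near a b ⇒ᵇ anyᶠ λ c → inBand c a ∧ inBand c b) refl a b

  inBoth : (∃ λ c → (inBand c a ∧ inBand c b) ≡ true) → ∃ λ c → a ∈ band c × b ∈ band c
  inBoth (c , both) = c , ∈-tabulate⁺ (inBand c) (∧-conicalˡ _ _ both) ,
                          ∈-tabulate⁺ (inBand c) (∧-conicalʳ (inBand c a) _ both)

triangle : ∀ {a b} → a ∈ band 0F → b ∈ band 0F → a ≢ b → near a b ≡ true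
triangle {a} {b} a∈ b∈ a≢b = modus-ponens
  (allᶠ²-sound (λ a b → (inBand 0F a ∧ inBand 0F b ∧ not (does (a ≟ b))) ⇒ᵇ near a b) refl a b)
  (cong₂ _∧_ (∈-tabulate⁻ (inBand 0F) a∈) (cong₂ _∧_ (∈-tabulate⁻ (inBand 0F) b∈) (cong not (dec-false (a ≟ b) a≢b))))

-- Two hunters cannot catch a rabbit confined to B.  A shot of at most two
-- hunters on B is recorded as a pair of vertices.
Shot : Set
Shot = Fin 10 × Fin 10

hits : Shot → Fin 10 → Bool
hits (x , y) w = does (w ≟ x) ∨ does (w ≟ y)

covered⇒hit : ∀ {b w} (s : Shot) → Covers s b → w ∈ b → hits s w ≡ true
covered⇒hit {w = w} (x , y) covers w∈b with covers w∈b
... | inj₁ w≡x = cong (_∨ does (w ≟ y)) (dec-true (w ≟ x) w≡x)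
... | inj₂ w≡y = trans (cong (does (w ≟ x) ∨_) (dec-true (w ≟ y) w≡y)) (∨-zeroʳ _)

missed⇒∉ : ∀ {b w} (s : Shot) → Covers s b → hits s w ≡ false → w ∉ b
missed⇒∉ s covers missed w∈b with trans (sym (covered⇒hit s covers w∈b)) missed
... | ()

-- The rabbit at v is trapped by a shot hitting all vertices of one of the
-- sets traps v, and safe otherwise.  The middle vertices 3,…,6 are never
-- trapped.
traps : Fin 10 → List (List (Fin 10))
traps 0F = (1F ∷ []) ∷ (2F ∷ []) ∷ []
traps 1F = (0F ∷ 3F ∷ []) ∷ (2F ∷ 3F ∷ []) ∷ []
traps 2F = (3F ∷ 4F ∷ []) ∷ []
traps 7F = (5F ∷ 6F ∷ []) ∷ []
traps 8F = (6F ∷ 7F ∷ []) ∷ (6F ∷ 9F ∷ []) ∷ []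
traps 9F = (7F ∷ []) ∷ (8F ∷ []) ∷ []
traps _  = []

safe : Fin 10 → Shot → Bool
safe v s = not (any (all (hits s)) (traps v))

-- Safety is self-sustaining: a rabbit at v, safe against the shot s, has a
-- neighbour w missed by s that is safe against any next shot s′.
Route : Fin 10 → Shot → Shot → Fin 10 → Bool
Route v s s′ w = near v w ∧ not (hits s w) ∧ safe w s′

Escapes : Fin 10 → Shot → Shot → Bool
Escapes v s s′ = safe v s ⇒ᵇ anyᶠ (Route v s s′)

allShots : (Shot → Bool) → Bool
allShots p = allᶠ² λ x y → p (x , y)

allShots-sound : ∀ p → allShots p ≡ true → ∀ s → p s ≡ true
allShots-sound p check (x , y) = allᶠ²-sound (λ x y → p (x , y)) check x y

escapeTable : Fin 10 → Bool
escapeTable v = allShots λ s → allShots (Escapes v s)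

escapeCheck : allᶠ escapeTable ≡ true
escapeCheck = refl

escapesEverywhere : ∀ v s s′ → Escapes v s s′ ≡ true
escapesEverywhere v s =
  allShots-sound (Escapes v s) (allShots-sound (λ s → allShots (Escapes v s)) (allᶠ-sound escapeTable escapeCheck v) s)

baseEscape : ∀ v s s′ → safe v s ≡ true →
             ∃ λ w → near v w ≡ true × hits s w ≡ false × safe w s′ ≡ true
baseEscape v s s′ safe-v =
  route (anyᶠ-sound (Route v s s′) (modus-ponens {safe v s} (escapesEverywhere v s s′) safe-v))
  where
  route : (∃ λ w → Route v s s′ w ≡ true) → ∃ λ w → near v w ≡ true × hits s w ≡ false × safe w s′ ≡ true
  route (w , found) =
    w , ∧-conicalˡ (near v w) _ found ,
    trans (sym (not-involutive (hits s w))) (cong not (∧-conicalˡ _ (safe w s′) (∧-conicalʳ (near v w) _ found))) ,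
    ∧-conicalʳ (not (hits s w)) _ (∧-conicalʳ (near v w) _ found)

middle : Subset 10
middle = outside ∷ outside ∷ outside ∷ inside ∷ inside ∷ inside ∷ inside ∷ outside ∷ outside ∷ outside ∷ []

middleSafe : ∀ {m} → m ∈ middle → ∀ s → safe m s ≡ true
middleSafe (there (there (there here)))                         s = refl
middleSafe (there (there (there (there here))))                 s = refl
middleSafe (there (there (there (there (there here)))))         s = refl
middleSafe (there (there (there (there (there (there here)))))) s = refl
middleSafe (there (there (there (there (there (there (there (there (there (there ())))))))))) s

middleMissedOr4≤ : ∀ (b : Subset 10) → (∃ λ m → m ∈ middle × m ∉ b) ⊎ 4 ≤ ∣ b ∣
middleMissedOr4≤ b with middle ⊆? b
... | yes middle⊆b = inj₂ (p⊆q⇒∣p∣≤∣q∣ middle⊆b)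
... | no  middle⊈b = inj₁ (⊈⇒∃ middle⊈b)

module Example (j : ℕ) where

  k : ℕ
  k = suc (suc j)

  V : Set
  V = Fin (10 + j)

  base : Fin 10 → V
  base a = a ↑ˡ j

  clique : Fin j → V
  clique u = 10 ↑ʳ u

  Link : Fin 10 ⊎ Fin j → Fin 10 ⊎ Fin j → Set
  Link (inj₁ a) (inj₁ b) = near a b ≡ true
  Link (inj₁ _) (inj₂ _) = Unit
  Link (inj₂ _) (inj₁ _) = Unit
  Link (inj₂ u) (inj₂ v) = u ≢ v

  link-sym : ∀ s t → Link s t → Link t s
  link-sym (inj₁ a) (inj₁ b) a~b = near-sym a b a~b
  link-sym (inj₁ _) (inj₂ _) _   = tt
  link-sym (inj₂ _) (inj₁ _) _   = tt
  link-sym (inj₂ u) (inj₂ v) u≢v = u≢v ∘ sym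

  link-irrefl : ∀ s → ¬ Link s s
  link-irrefl (inj₁ a) = near-irrefl a
  link-irrefl (inj₂ u) u≢u = u≢u refl

  G : Graph
  G = record
    { n      = 10 + j
    ; Adj    = λ x y → Link (splitAt 10 x) (splitAt 10 y)
    ; sym    = λ {x} {y} → link-sym (splitAt 10 x) (splitAt 10 y)
    ; irrefl = λ {x} → link-irrefl (splitAt 10 x)
    }

  data Kind : V → Set where
    isBase   : ∀ a → Kind (base a)
    isClique : ∀ u → Kind (clique u)

  kind : ∀ x → Kind x
  kind x with splitAt 10 x in eq
  ... | inj₁ a = subst Kind (splitAt⁻¹-↑ˡ eq) (isBase a)
  ... | inj₂ u = subst Kind (splitAt⁻¹-↑ʳ eq) (isClique u)

  split-base : ∀ a → splitAt 10 (base a) ≡ inj₁ a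
  split-base a = splitAt-↑ˡ 10 a j

  split-clique : ∀ u → splitAt 10 (clique u) ≡ inj₂ u
  split-clique u = splitAt-↑ʳ 10 j u

  adj-base : ∀ a b → near a b ≡ true → Adj G (base a) (base b)
  adj-base a b a~b rewrite split-base a | split-base b = a~b

  adj-base⁻ : ∀ a b → Adj G (base a) (base b) → near a b ≡ true
  adj-base⁻ a b a~b rewrite split-base a | split-base b = a~b

  adj-base-clique : ∀ a u → Adj G (base a) (clique u)
  adj-base-clique a u rewrite split-base a | split-clique u = tt

  adj-clique-base : ∀ u a → Adj G (clique u) (base a)
  adj-clique-base u a rewrite split-base a | split-clique u = tt

  adj-clique : ∀ {u v} → u ≢ v → Adj G (clique u) (clique v)
  adj-clique {u} {v} u≢v rewrite split-clique u | split-clique v = u≢v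

  bag₀ : Fin 8 → Subset (10 + j)
  bag₀ c = band c ++ full

  base∈bag₀ : ∀ c {a} → a ∈ band c → base a ∈ bag₀ c
  base∈bag₀ c = ∈-++ˡ⁺

  base∈bag₀⁻ : ∀ c a → base a ∈ bag₀ c → a ∈ band c
  base∈bag₀⁻ c a = ∈-++ˡ⁻ (band c)

  clique∈bag₀ : ∀ u c → clique u ∈ bag₀ c
  clique∈bag₀ u c = ∈-++ʳ⁺ (band c) ∈⊤

  cover₀ : ∀ x → ∃ λ c → x ∈ bag₀ c
  cover₀ x with kind x
  ... | isBase a   = let c , a∈c = band-cover a in c , base∈bag₀ c a∈c
  ... | isClique u = 0F , clique∈bag₀ u 0F

  edges₀ : ∀ x y → Adj G x y → ∃ λ c → x ∈ bag₀ c × y ∈ bag₀ c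
  edges₀ x y x~y with kind x | kind y
  ... | isBase a   | isBase b   = let c , a∈c , b∈c = band-edge (adj-base⁻ a b x~y) in c , base∈bag₀ c a∈c , base∈bag₀ c b∈c
  ... | isBase a   | isClique u = let c , a∈c = band-cover a in c , base∈bag₀ c a∈c , clique∈bag₀ u c
  ... | isClique u | isBase a   = let c , a∈c = band-cover a in c , clique∈bag₀ u c , base∈bag₀ c a∈c
  ... | isClique u | isClique v = 0F , clique∈bag₀ u 0F , clique∈bag₀ v 0F

  interpolation₀ : ∀ x (c r l : Fin 8) → toℕ c ≤ toℕ r → toℕ r ≤ toℕ l →
                   x ∈ bag₀ c → x ∈ bag₀ l → x ∈ bag₀ r
  interpolation₀ x c r l c≤r r≤l x∈c x∈l with kind x
  ... | isBase a   = base∈bag₀ r (band-interpolation c≤r r≤l (base∈bag₀⁻ c a x∈c) (base∈bag₀⁻ l a x∈l))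
  ... | isClique u = clique∈bag₀ u r

  D₀ : PathDecomposition G
  D₀ = record { ℓ = 8 ; bag = bag₀ ; cover = cover₀ ; edges = edges₀ ; interpolation = interpolation₀ }

  ∣bag₀∣ : ∀ c → ∣ bag₀ c ∣ ≡ 3 + j
  ∣bag₀∣ c = trans (∣++∣ (band c) (full {j})) (cong₂ _+_ (band-size c) (∣⊤∣≡n j))

  width₀ : width D₀ ≡ k
  width₀ = cong (_∸ 1) (maxBag-exact D₀ ∣bag₀∣ 0F)

  -- The first bag, {0, 1, 2} together with the clique, is a clique of G
  -- with k + 1 vertices; so no path decomposition is narrower than D₀.
  bag₀-clique : IsClique G (bag₀ 0F)
  bag₀-clique {x} {y} x∈ y∈ x≢y with kind x | kind y
  ... | isBase a   | isBase b   = adj-base a b (triangle (base∈bag₀⁻ 0F a x∈) (base∈bag₀⁻ 0F b y∈) (x≢y ∘ cong base))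
  ... | isBase a   | isClique u = adj-base-clique a u
  ... | isClique u | isBase a   = adj-clique-base u a
  ... | isClique u | isClique v = adj-clique (x≢y ∘ cong clique)

  pathwidth : IsPathwidth G k
  pathwidth = (D₀ , width₀) , λ D → subst (_≤ width D) (cong (_∸ 1) (∣bag₀∣ 0F)) (width≥∣clique∣-1 D bag₀-clique)

  baseShots : Subset (10 + j) → Subset 10
  baseShots = take 10

  cliqueShots : Subset (10 + j) → Subset j
  cliqueShots = drop 10

  split-shots : ∀ H → H ≡ baseShots H ++ cliqueShots H
  split-shots H = sym (take++drop≡id 10 H)

  shot-base : ∀ {H a} → base a ∈ H → a ∈ baseShots H
  shot-base {H} a∈H = ∈-++ˡ⁻ (baseShots H) (subst (_ ∈_) (split-shots H) a∈H)

  shot-clique : ∀ {H u} → clique u ∈ H → u ∈ cliqueShots H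
  shot-clique {H} u∈H = ∈-++ʳ⁻ (baseShots H) (subst (_ ∈_) (split-shots H) u∈H)

  ∣shots∣ : ∀ H → ∣ H ∣ ≡ ∣ baseShots H ∣ + ∣ cliqueShots H ∣
  ∣shots∣ H = trans (cong ∣_∣ (split-shots H)) (∣++∣ (baseShots H) (cliqueShots H))

  cliqueMissedOrPair : ∀ H → ∣ H ∣ ≤ k → (∃ λ u → clique u ∉ H) ⊎ (∃ λ s → Covers s (baseShots H))
  cliqueMissedOrPair H small with ∣ cliqueShots H ∣ <? j
  ... | yes few  = let u , u∉ = missing (cliqueShots H) few in inj₁ (u , u∉ ∘ shot-clique)
  ... | no  many = inj₂ (pairCover (baseShots H) (+-cancelʳ-≤ j _ 2 (begin
    ∣ baseShots H ∣ + j                   ≤⟨ +-monoʳ-≤ ∣ baseShots H ∣ (≮⇒≥ many) ⟩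
    ∣ baseShots H ∣ + ∣ cliqueShots H ∣   ≡⟨ sym (∣shots∣ H) ⟩
    ∣ H ∣                                 ≤⟨ small ⟩
    2 + j                                 ∎)))
    where open ≤-Reasoning

  middleMissedOrRoom : ∀ H → ∣ H ∣ ≤ k → (∃ λ m → m ∈ middle × base m ∉ H) ⊎ 2 + ∣ cliqueShots H ∣ ≤ j
  middleMissedOrRoom H small with middleMissedOr4≤ (baseShots H)
  ... | inj₁ (m , m∈ , m∉) = inj₁ (m , m∈ , m∉ ∘ shot-base)
  ... | inj₂ 4≤∣base∣      = inj₂ (+-cancelˡ-≤ 2 _ _ (begin
    4 + ∣ cliqueShots H ∣                 ≤⟨ +-monoˡ-≤ ∣ cliqueShots H ∣ 4≤∣base∣ ⟩
    ∣ baseShots H ∣ + ∣ cliqueShots H ∣   ≡⟨ sym (∣shots∣ H) ⟩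
    ∣ H ∣                                 ≤⟨ small ⟩
    2 + j                                 ∎))
    where open ≤-Reasoning

  -- The invariant: the rabbit is missed by the current shot and, if on a
  -- base vertex a, is prepared for the next shot H: either a clique vertex
  -- will be free, or a is safe against a pair covering H's base part.
  Prepared : Fin 10 ⊎ Fin j → Subset (10 + j) → Set
  Prepared (inj₁ a) H = (∃ λ u → clique u ∉ H) ⊎ (∃ λ s → Covers s (baseShots H) × safe a s ≡ true)
  Prepared (inj₂ _) H = Unit

  Safe : V → Subset (10 + j) → Subset (10 + j) → Set
  Safe x H H′ = x ∉ H × Prepared (splitAt 10 x) H′

  safe-base : ∀ {a H} H′ → base a ∉ H → Prepared (inj₁ a) H′ → Safe (base a) H H′
  safe-base {a} H′ a∉H prepared = a∉H , subst (λ t → Prepared t H′) (sym (split-base a)) prepared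

  safe-clique : ∀ {u H} H′ → clique u ∉ H → Safe (clique u) H H′
  safe-clique {u} H′ u∉H = u∉H , subst (λ t → Prepared t H′) (sym (split-clique u)) tt

  forecast : ∀ H → ∣ H ∣ ≤ k → ∃ λ s → ∀ a → safe a s ≡ true → Prepared (inj₁ a) H
  forecast H small with cliqueMissedOrPair H small
  ... | inj₁ missed          = (0F , 0F) , λ _ _ → inj₁ missed
  ... | inj₂ (s , covers)    = s , λ _ safe-a → inj₂ (s , covers , safe-a)

  shelter : ∀ H H′ → ∣ H ∣ ≤ k → ∣ H′ ∣ ≤ k → (∃ λ m → Safe (base m) H H′) ⊎ 2 + ∣ cliqueShots H ∣ ≤ j
  shelter H H′ small small′ with middleMissedOrRoom H small
  ... | inj₁ (m , m∈ , m∉) = let s , prepared = forecast H′ small′ in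
                             inj₁ (m , safe-base H′ m∉ (prepared m (middleSafe m∈ s)))
  ... | inj₂ room          = inj₂ room

  start : ∀ H H′ → ∣ H ∣ ≤ k → ∣ H′ ∣ ≤ k → ∃ λ x → Safe x H H′
  start H H′ small small′ with shelter H H′ small small′
  ... | inj₁ (m , safe-m) = base m , safe-m
  ... | inj₂ room         = let u , u∉ = missing (cliqueShots H) (≤-trans (n≤1+n _) room) in
                            clique u , safe-clique H′ (u∉ ∘ shot-clique)

  -- From a clique vertex: shelter in the middle, or move along the clique.
  -- From a base vertex: jump to a free clique vertex, or escape within B.
  move : ∀ {x H} H′ H″ → ∣ H′ ∣ ≤ k → ∣ H″ ∣ ≤ k → Safe x H H′ → ∃ λ y → Adj G x y × Safe y H′ H″
  move {x} H′ H″ small′ small″ (_ , prepared) with kind x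
  ... | isClique u₀ with shelter H′ H″ small′ small″
  ...   | inj₁ (m , safe-m) = base m , adj-clique-base u₀ m , safe-m
  ...   | inj₂ room         = let u , u∉ , u≢u₀ = missingBesides (cliqueShots H′) room u₀ in
                              clique u , adj-clique (u≢u₀ ∘ sym) , safe-clique H″ (u∉ ∘ shot-clique)
  move {x} H′ H″ small′ small″ (_ , prepared) | isBase a
    with subst (λ t → Prepared t H′) (split-base a) prepared
  ... | inj₁ (u , u∉)               = clique u , adj-base-clique a u , safe-clique H″ u∉
  ... | inj₂ (s , covers , safe-a) =
    let s″ , prepared″        = forecast H″ small″
        w , a~w , missed , safe-w = baseEscape a s s″ safe-a
    in base w , adj-base a w a~w , safe-base H″ (missed⇒∉ s covers missed ∘ shot-base) (prepared″ w safe-w)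

  rabbitPlan : EscapePlan G k
  rabbitPlan = record { Safe = Safe ; missed = proj₁ ; start = start ; move = move }

  hunterNumber : IsHunterNumber G (k + 1)
  hunterNumber = isHunterNumber {G}
    (subst (λ w → HuntersWin G (w + 1)) width₀ (huntersWin-width+1 {G} D₀))
    (λ m m<k+1 win → escape rabbitPlan (huntersWin-mono {G} (m<1+n⇒m≤n (subst (m <_) (+-comm k 1) m<k+1)) win))

proposition12 : (∀ (G : Graph) (p h : ℕ) → IsPathwidth G p → IsHunterNumber G h → h ≤ p + 1)
                × (∀ (k : ℕ) → 2 ≤ k → ∃[ G ] (IsPathwidth G k × IsHunterNumber G (k + 1)))
proposition12 = upperBound , tightness
  where
  upperBound : ∀ (G : Graph) (p h : ℕ) → IsPathwidth G p → IsHunterNumber G h → h ≤ p + 1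
  upperBound G p h ((D , width≡p) , _) (_ , least) =
    least (p + 1) (subst (λ w → HuntersWin G (w + 1)) width≡p (huntersWin-width+1 D))

  tightness : ∀ (k : ℕ) → 2 ≤ k → ∃[ G ] (IsPathwidth G k × IsHunterNumber G (k + 1))
  tightness 1 (s≤s ())
  tightness (suc (suc j)) _ = Example.G j , Example.pathwidth j , Example.hunterNumber j
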